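{- Let $k\ge 2$ be an integer and let $G$ be an $n$-vertex bipartite graph with average degree $d>0$. Suppose that $G$ contains no proper subgraph with larger average degree. Then $G$ contains a subgraph $G'$ with bipartition $(A,B)$ such that, for some positive integer $i$: (1) $|A|\ge \frac1k 2^{ -\frac{ki}{k-1}} n$ and $|B|\ge \frac{n}{64}$; (2) $d_{G'}(a)\in[2^{i-6}d,\,2^{i-5}d]$ for all $a\in A$; (3) $d_{G'}(b)\le 4d$ for all $b\in B$.
   Context: $d_{G'}(v)$ denotes the degree of vertex $v$ in $G'$. -}

module Defs where

open import Data.Nat using (ℕ; zero; suc; _+_; _*_)
open import Data.Bool using (Bool; true; false)
open import Data.Fin using (Fin)
open import Data.List using (List; map; allFin)
open import Data.Nat.ListAction using (sum)
open import Data.Product using (_×_; Σ)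
open import Relation.Nullary using (¬_)
open import Relation.Binary.PropositionalEquality using (_≡_; _≢_)

count : {n : ℕ} → (Fin n → Bool) → ℕ
count {n} p = sum (map (λ v → if-true (p v)) (allFin n))
  where
  if-true : Bool → ℕ
  if-true true  = 1
  if-true false = 0

record Graph (n : ℕ) : Set where
  field
    adj    : Fin n → Fin n → Bool
    sym    : ∀ u v → adj u v ≡ adj v u
    irrefl : ∀ u → adj u u ≡ false

open Graph public

deg : {n : ℕ} → Graph n → Fin n → ℕ
deg G u = count (adj G u)

-- sum of all degrees = 2|E(G)| = n · (average degree of G)
degSum : {n : ℕ} → Graph n → ℕ
degSum {n} G = sum (map (deg G) (allFin n))

Bipartite : {n : ℕ} → Graph n → Set
Bipartite {n} G = Σ (Fin n → Bool) λ c → ∀ u v → adj G u v ≡ true → c u ≢ c v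

record Subgraph {n : ℕ} (G : Graph n) : Set where
  field
    V     : Fin n → Bool
    E     : Fin n → Fin n → Bool
    E-sym : ∀ u v → E u v ≡ E v u
    E⊆G   : ∀ u v → E u v ≡ true → adj G u v ≡ true
    E⊆V   : ∀ u v → E u v ≡ true → V u ≡ true

open Subgraph public

degS : {n : ℕ} {G : Graph n} → Subgraph G → Fin n → ℕ
degS H u = count (E H u)

vcount : {n : ℕ} {G : Graph n} → Subgraph G → ℕ
vcount H = count (V H)

-- sum of degrees in H = 2|E(H)| = |V(H)| · (average degree of H)
degSumS : {n : ℕ} {G : Graph n} → Subgraph G → ℕ
degSumS {n} H = sum (map (degS H) (allFin n))

Proper : {n : ℕ} {G : Graph n} → Subgraph G → Set
Proper {n} {G} H = ¬ ((∀ u → V H u ≡ true) × (∀ u v → E H u v ≡ adj G u v))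

IsBipartition : {n : ℕ} {G : Graph n} → Subgraph G → (Fin n → Bool) → (Fin n → Bool) → Set
IsBipartition {n} H A B =
  (∀ u → ¬ (A u ≡ true × B u ≡ true)) ×
  (∀ u → V H u ≡ true → (A u ≡ true) Data.Sum.⊎ (B u ≡ true)) ×
  (∀ u → A u ≡ true → V H u ≡ true) ×
  (∀ u → B u ≡ true → V H u ≡ true) ×
  (∀ u v → E H u v ≡ true → (A u ≡ true × B v ≡ true) Data.Sum.⊎ (B u ≡ true × A v ≡ true))
  where import Data.Sum

{-# OPTIONS --safe #-}
-- A graph with no denser proper subgraph has minimum degree at least d/2, since deleting a
-- vertex of smaller degree would raise the average degree. At least 3n/4 vertices have degree
-- at most 4d, so one colour class contains a set B of at least 3n/8 of them, and at least
-- 3nd/16 edges end in B. Split the vertices x of the other class into dyadic windows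
-- A_i = {x : 2^(i-6) d ≤ d_B(x) < 2^(i-5) d} and let H be the bipartite graph between A_i and B.
-- If no window satisfied the size bound (1), then k |A_i| 2^i 2^q < n whenever q (k-1) ≤ i;
-- summing over blocks of k-1 consecutive windows gives Σ_i |A_i| 2^i ≤ 2n, so the windows send
-- at most nd/16 edges to B and the vertices below all windows fewer than nd/32, which
-- contradicts the 3nd/16 edges ending in B.
module Submission where

open import Defs hiding (sym)
open import Data.Nat using (ℕ; _+_; _*_; _∸_; _^_; _≤_; _<_)
open import Data.Bool using (Bool; true)
open import Data.Fin using (Fin)
open import Data.Product using (_×_; Σ; ∃)
open import Relation.Binary.PropositionalEquality using (_≡_)

open import Data.Nat using (zero; suc; z≤n; s≤s; s≤s⁻¹; NonZero; >-nonZero; _≤ᵇ_; _<ᵇ_; _≤?_)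
open import Data.Nat.Properties hiding (_≟_)
open import Data.Nat.Tactic.RingSolver using (solve-∀; solve)
open import Algebra.Properties.CommutativeSemigroup *-commutativeSemigroup using (x∙yz≈y∙xz; xy∙z≈xz∙y)
open import Data.Bool using (false; not; _∧_; _∨_; T)
open import Data.Bool.Properties using (∧-comm; ∨-comm; ∨-identityʳ; ¬-not; not-injective)
open import Data.Fin using (toℕ; fromℕ<; _↑ˡ_; _↑ʳ_; combine) renaming (zero to fzero; suc to fsuc)
open import Data.Fin.Properties using (_≟_; any?; toℕ-fromℕ<; toℕ-combine)
open import Data.List using (map; allFin; tabulate; []; _∷_)
open import Data.List.Properties using (map-tabulate)
open import Data.Nat.ListAction using (sum)
open import Data.Product using (_,_; proj₁; proj₂; ∃-syntax)
open import Data.Sum using (_⊎_; inj₁; inj₂; [_,_]′)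
open import Data.Unit using (tt)
open import Function using (_∘_; id)
open import Relation.Nullary using (¬_; yes; no; does; contradiction)
open import Relation.Unary using (Decidable)
open import Relation.Nullary.Reflects using (ofⁿ)
open import Relation.Binary.PropositionalEquality
  using (refl; sym; trans; cong; cong₂; subst; subst₂; _≢_; module ≡-Reasoning)
open import Algebra.Properties.Semiring.Sum +-*-semiring
  using (sum-syntax; sum-cong-≗; ∑-distrib-+; ∑-comm; *-distribˡ-sum; *-distribʳ-sum)
  renaming (sum to ∑)

true⇒T : ∀ {b} → b ≡ true → T b
true⇒T refl = tt

T⇒true : ∀ {b} → T b → b ≡ true
T⇒true {true} _ = refl

∧-true⁺ : ∀ {a b} → a ≡ true → b ≡ true → a ∧ b ≡ true
∧-true⁺ refl b≡true = b≡true

∧-true⁻ : ∀ {a b} → a ∧ b ≡ true → a ≡ true × b ≡ true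
∧-true⁻ {true} b≡true = refl , b≡true

∨-true⁻ : ∀ {a b} → a ∨ b ≡ true → a ≡ true ⊎ b ≡ true
∨-true⁻ {true}  _       = inj₁ refl
∨-true⁻ {false} b≡true  = inj₂ b≡true

∨-trueˡ : ∀ {a} b → a ≡ true → a ∨ b ≡ true
∨-trueˡ b refl = refl

∨-trueʳ : ∀ a {b} → b ≡ true → a ∨ b ≡ true
∨-trueʳ true  _ = refl
∨-trueʳ false b≡true = b≡true

𝟙 : Bool → ℕ
𝟙 true  = 1
𝟙 false = 0

𝟙≤1 : ∀ b → 𝟙 b ≤ 1
𝟙≤1 true  = ≤-refl
𝟙≤1 false = z≤n

𝟙-∧ : ∀ a b → 𝟙 (a ∧ b) ≡ 𝟙 a * 𝟙 b
𝟙-∧ true  true  = refl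
𝟙-∧ true  false = refl
𝟙-∧ false b     = refl

𝟙-mono : ∀ {a b} → (a ≡ true → b ≡ true) → 𝟙 a ≤ 𝟙 b
𝟙-mono {false} a⇒b = z≤n
𝟙-mono {true}  a⇒b rewrite a⇒b refl = ≤-refl

-- Finite sums and counting

sum-tabulate : ∀ {n} (f : Fin n → ℕ) → sum (tabulate f) ≡ ∑ f
sum-tabulate {zero}  f = refl
sum-tabulate {suc n} f = cong (f fzero +_) (sum-tabulate (f ∘ fsuc))

sum-map-allFin : ∀ {n} (f : Fin n → ℕ) → sum (map f (allFin n)) ≡ ∑ f
sum-map-allFin f = trans (cong sum (map-tabulate id f)) (sum-tabulate f)

∑-mono-≤ : ∀ {n} {f g : Fin n → ℕ} → (∀ i → f i ≤ g i) → ∑ f ≤ ∑ g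
∑-mono-≤ {zero}  f≤g = z≤n
∑-mono-≤ {suc n} f≤g = +-mono-≤ (f≤g fzero) (∑-mono-≤ (f≤g ∘ fsuc))

∑-const : ∀ n c → ∑[ i < n ] c ≡ n * c
∑-const zero    c = refl
∑-const (suc n) c = cong (c +_) (∑-const n c)

∑-≤-const : ∀ {n} {f : Fin n → ℕ} {c} → (∀ i → f i ≤ c) → ∑ f ≤ n * c
∑-≤-const {n} {c = c} f≤c = subst (_ ≤_) (∑-const n c) (∑-mono-≤ f≤c)

∑-term : ∀ {n} (f : Fin n → ℕ) i → f i ≤ ∑ f
∑-term f fzero    = m≤m+n _ _
∑-term f (fsuc i) = ≤-trans (∑-term (f ∘ fsuc) i) (m≤n+m _ _)

_≡ᵇ_ : ∀ {n} → Fin n → Fin n → Bool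
u ≡ᵇ v = does (u ≟ v)

∑-δ : ∀ {n} (f : Fin n → ℕ) v → ∑[ u < n ] (𝟙 (u ≡ᵇ v) * f u) ≡ f v
∑-δ {suc n} f fzero    =
  trans (cong₂ _+_ (*-identityˡ (f fzero)) (trans (∑-const n 0) (*-zeroʳ n))) (+-identityʳ _)
∑-δ {suc n} f (fsuc v) = ∑-δ (f ∘ fsuc) v

∑-↑ : ∀ m {k} (f : Fin (m + k) → ℕ) → ∑ f ≡ ∑[ i < m ] f (i ↑ˡ k) + ∑[ i < k ] f (m ↑ʳ i)
∑-↑ zero    f = refl
∑-↑ (suc m) f = trans (cong (f fzero +_) (∑-↑ m (f ∘ fsuc))) (sym (+-assoc (f fzero) _ _))

∑-combine : ∀ Q m (f : Fin (Q * m) → ℕ) → ∑ f ≡ ∑[ q < Q ] ∑[ r < m ] f (combine q r)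
∑-combine zero    m f = refl
∑-combine (suc Q) m f = trans (∑-↑ m f) (cong (∑[ r < m ] f (r ↑ˡ Q * m) +_) (∑-combine Q m (f ∘ (m ↑ʳ_))))

∑-geometric : ∀ {Q} e {c} (h : Fin Q → ℕ) → (∀ q → 2 ^ (e + toℕ q) * h q ≤ c) → 2 ^ e * ∑ h ≤ 2 * c
∑-geometric {zero}  e {c} h bound = subst (_≤ 2 * c) (sym (*-zeroʳ (2 ^ e))) z≤n
∑-geometric {suc Q} e {c} h bound = begin
  2 ^ e * (h fzero + ∑ (h ∘ fsuc))          ≡⟨ *-distribˡ-+ (2 ^ e) _ _ ⟩
  2 ^ e * h fzero + 2 ^ e * ∑ (h ∘ fsuc)    ≤⟨ +-mono-≤ head tail ⟩
  c + c                                      ≡⟨ cong (c +_) (sym (+-identityʳ c)) ⟩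
  2 * c                                      ∎
  where
  open ≤-Reasoning
  head : 2 ^ e * h fzero ≤ c
  head = subst (λ d → 2 ^ d * h fzero ≤ c) (+-identityʳ e) (bound fzero)
  tail : 2 ^ e * ∑ (h ∘ fsuc) ≤ c
  tail = *-cancelˡ-≤ 2 (subst (_≤ 2 * c) (*-assoc 2 (2 ^ e) _)
           (∑-geometric (suc e) (h ∘ fsuc) (λ q → subst (λ d → 2 ^ d * h (fsuc q) ≤ c)
                                                          (+-suc e (toℕ q)) (bound (fsuc q)))))

-- Block q of m consecutive terms has total at most c / 2^q, so the sum is at most 2c.
∑-blocks-bound : ∀ Q m .{{_ : NonZero m}} c (g : Fin (Q * m) → ℕ) →
  (∀ (q : Fin Q) (r : Fin m) → m * 2 ^ toℕ q * g (combine q r) ≤ c) → ∑ g ≤ 2 * c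
∑-blocks-bound Q m c g bound = begin
  ∑ g                                               ≡⟨ ∑-combine Q m g ⟩
  ∑[ q < Q ] ∑[ r < m ] g (combine q r)             ≡⟨ sym (*-identityˡ _) ⟩
  2 ^ 0 * ∑[ q < Q ] ∑[ r < m ] g (combine q r)     ≤⟨ ∑-geometric 0 _ block ⟩
  2 * c                                             ∎
  where
  open ≤-Reasoning
  block : ∀ (q : Fin Q) → 2 ^ toℕ q * ∑[ r < m ] g (combine q r) ≤ c
  block q = *-cancelˡ-≤ m (begin
    m * (2 ^ toℕ q * ∑[ r < m ] g (combine q r))     ≡⟨ sym (*-assoc m _ _) ⟩
    m * 2 ^ toℕ q * ∑[ r < m ] g (combine q r)       ≡⟨ *-distribˡ-sum (m * 2 ^ toℕ q) (g ∘ combine q) ⟩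
    ∑[ r < m ] (m * 2 ^ toℕ q * g (combine q r))     ≤⟨ ∑-≤-const (bound q) ⟩
    m * c                                            ∎)

-- `count` sums an indicator that is local to Defs; χ names it by unification.
count≡∑𝟙 : ∀ {n} (p : Fin n → Bool) → count p ≡ ∑[ v < n ] 𝟙 (p v)
count≡∑𝟙 {n} p = trans unfold (trans (sum-map-allFin χ) (sum-cong-≗ χ≗𝟙))
  where
  χ : Fin n → ℕ
  χ = _
  unfold : count p ≡ sum (map χ (allFin n))
  unfold = refl
  χ≗𝟙 : ∀ v → χ v ≡ 𝟙 (p v)
  χ≗𝟙 v with p v
  ... | true  = refl
  ... | false = refl

count-mono : ∀ {n} {p q : Fin n → Bool} → (∀ v → p v ≡ true → q v ≡ true) → count p ≤ count q
count-mono {p = p} {q} p⊆q =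
  subst₂ _≤_ (sym (count≡∑𝟙 p)) (sym (count≡∑𝟙 q)) (∑-mono-≤ (λ v → 𝟙-mono (p⊆q v)))

count≤n : ∀ {n} (p : Fin n → Bool) → count p ≤ n
count≤n {n} p = subst₂ _≤_ (sym (count≡∑𝟙 p)) (*-identityʳ n) (∑-≤-const (𝟙≤1 ∘ p))

count-∧-split : ∀ {n} (p q : Fin n → Bool) →
  count p ≡ count (λ v → p v ∧ q v) + count (λ v → p v ∧ not (q v))
count-∧-split p q = begin
  count p                                   ≡⟨ count≡∑𝟙 p ⟩
  ∑ (λ v → 𝟙 (p v))                         ≡⟨ sum-cong-≗ (λ v → split (p v) (q v)) ⟩
  ∑ (λ v → 𝟙 (p∧q v) + 𝟙 (p∧¬q v))          ≡⟨ ∑-distrib-+ (𝟙 ∘ p∧q) (𝟙 ∘ p∧¬q) ⟩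
  ∑ (λ v → 𝟙 (p∧q v)) + ∑ (λ v → 𝟙 (p∧¬q v)) ≡⟨ sym (cong₂ _+_ (count≡∑𝟙 p∧q) (count≡∑𝟙 p∧¬q)) ⟩
  count p∧q + count p∧¬q                    ∎
  where
  open ≡-Reasoning
  p∧q p∧¬q : Fin _ → Bool
  p∧q  v = p v ∧ q v
  p∧¬q v = p v ∧ not (q v)
  split : ∀ a b → 𝟙 a ≡ 𝟙 (a ∧ b) + 𝟙 (a ∧ not b)
  split true  true  = refl
  split true  false = refl
  split false b     = refl

count-cong : ∀ {n} {p q : Fin n → Bool} → (∀ v → p v ≡ q v) → count p ≡ count q
count-cong {p = p} {q} p≗q = trans (count≡∑𝟙 p) (trans (sum-cong-≗ (cong 𝟙 ∘ p≗q)) (sym (count≡∑𝟙 q)))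

count-above : ∀ {n} (f : Fin n → ℕ) c → c * count (λ v → not (f v ≤ᵇ c)) ≤ ∑ f
count-above {n} f c = begin
  c * count above                ≡⟨ cong (c *_) (count≡∑𝟙 above) ⟩
  c * ∑[ v < n ] 𝟙 (above v)     ≡⟨ *-distribˡ-sum c (𝟙 ∘ above) ⟩
  ∑[ v < n ] (c * 𝟙 (above v))   ≤⟨ ∑-mono-≤ bound ⟩
  ∑ f                            ∎
  where
  open ≤-Reasoning
  above : Fin n → Bool
  above v = not (f v ≤ᵇ c)
  bound : ∀ v → c * 𝟙 (above v) ≤ f v
  bound v with f v ≤ᵇ c | ≤ᵇ-reflects-≤ (f v) c
  ... | true  | _       = subst (_≤ f v) (sym (*-zeroʳ c)) z≤n
  ... | false | ofⁿ f≰c = subst (_≤ f v) (sym (*-identityʳ c)) (<⇒≤ (≰⇒> f≰c))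

-- Degrees and vertex deletion

degSum≡∑deg : ∀ {n} (G : Graph n) → degSum G ≡ ∑ (deg G)
degSum≡∑deg G = sum-map-allFin (deg G)

degSumS≡∑degS : ∀ {n} {G : Graph n} (H : Subgraph G) → degSumS H ≡ ∑ (degS H)
degSumS≡∑degS H = sum-map-allFin (degS H)

deg≡∑𝟙adj : ∀ {n} (G : Graph n) v → deg G v ≡ ∑[ u < n ] 𝟙 (adj G u v)
deg≡∑𝟙adj G v = trans (count≡∑𝟙 (adj G v)) (sum-cong-≗ (λ u → cong 𝟙 (Graph.sym G v u)))

degSum-positive⇒2≤n : ∀ {n} (G : Graph n) → 0 < degSum G → 2 ≤ n
degSum-positive⇒2≤n {zero}        G ()
degSum-positive⇒2≤n {suc zero}    G 0<D
  rewrite degSum≡∑deg G | count≡∑𝟙 (adj G fzero) | irrefl G fzero = contradiction 0<D (<-irrefl refl)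
degSum-positive⇒2≤n {suc (suc n)} G _ = s≤s (s≤s z≤n)

_─_ : ∀ {n} (G : Graph n) → Fin n → Subgraph G
G ─ v = record
  { V     = kept
  ; E     = λ u w → adj G u w ∧ (kept u ∧ kept w)
  ; E-sym = λ u w → cong₂ _∧_ (Graph.sym G u w) (∧-comm (kept u) (kept w))
  ; E⊆G   = λ u w → proj₁ ∘ ∧-true⁻
  ; E⊆V   = λ u w → proj₁ ∘ ∧-true⁻ ∘ proj₂ ∘ ∧-true⁻ {adj G u w}
  }
  where
  kept : Fin _ → Bool
  kept u = not (u ≡ᵇ v)

─-proper : ∀ {n} (G : Graph n) v → Proper (G ─ v)
─-proper G v (all-kept , _) with v ≟ v | all-kept v
... | yes _   | ()
... | no v≢v  | _ = v≢v refl

vcount-─ : ∀ {n} (G : Graph n) v → vcount (G ─ v) + 1 ≡ n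
vcount-─ {n} G v = begin
  vcount (G ─ v) + 1                                   ≡⟨ cong₂ _+_ (count≡∑𝟙 kept) (sym (∑-δ (λ _ → 1) v)) ⟩
  ∑[ u < n ] 𝟙 (kept u) + ∑[ u < n ] (𝟙 (u ≡ᵇ v) * 1)  ≡⟨ sym (∑-distrib-+ (𝟙 ∘ kept) _) ⟩
  ∑[ u < n ] (𝟙 (kept u) + 𝟙 (u ≡ᵇ v) * 1)             ≡⟨ sum-cong-≗ (λ u → 𝟙-not+𝟙 (u ≡ᵇ v)) ⟩
  ∑[ u < n ] 1                                         ≡⟨ trans (∑-const n 1) (*-identityʳ n) ⟩
  n                                                    ∎
  where
  open ≡-Reasoning
  kept : Fin n → Bool
  kept u = not (u ≡ᵇ v)
  𝟙-not+𝟙 : ∀ b → 𝟙 (not b) + 𝟙 b * 1 ≡ 1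
  𝟙-not+𝟙 true  = refl
  𝟙-not+𝟙 false = refl

degSum≤degSumS-─ : ∀ {n} (G : Graph n) v → degSum G ≤ degSumS (G ─ v) + 2 * deg G v
degSum≤degSumS-─ {n} G v = begin
  degSum G
    ≡⟨ trans (degSum≡∑deg G) (sum-cong-≗ (count≡∑𝟙 ∘ adj G)) ⟩
  ∑[ u < n ] ∑[ w < n ] 𝟙 (adj G u w)
    ≤⟨ ∑-mono-≤ (λ u → ∑-mono-≤ (λ w → edge-split (adj G u w) (at u) (at w))) ⟩
  ∑[ u < n ] ∑[ w < n ] (𝟙 (E H u w) + 𝟙 (at u) * 𝟙 (adj G u w) + 𝟙 (at w) * 𝟙 (adj G u w))
    ≡⟨ sum-cong-≗ row ⟩
  ∑[ u < n ] (degS H u + 𝟙 (at u) * deg G u + 𝟙 (adj G u v))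
    ≡⟨ trans (∑-distrib-+ {n} (λ u → degS H u + 𝟙 (at u) * deg G u) (λ u → 𝟙 (adj G u v)))
             (cong (_+ ∑[ u < n ] 𝟙 (adj G u v)) (∑-distrib-+ (degS H) (λ u → 𝟙 (at u) * deg G u))) ⟩
  ∑ (degS H) + ∑[ u < n ] (𝟙 (at u) * deg G u) + ∑[ u < n ] 𝟙 (adj G u v)
    ≡⟨ cong₂ _+_ (cong₂ _+_ (sym (degSumS≡∑degS H)) (∑-δ (deg G) v)) (sym (deg≡∑𝟙adj G v)) ⟩
  degSumS H + deg G v + deg G v
    ≡⟨ trans (+-assoc (degSumS H) _ _) (cong (λ d → degSumS H + (deg G v + d)) (sym (+-identityʳ _))) ⟩
  degSumS H + 2 * deg G v
    ∎
  where
  open ≤-Reasoning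
  H : Subgraph G
  H = G ─ v
  at : Fin n → Bool
  at u = u ≡ᵇ v
  -- An edge of G either survives in G ─ v or is incident to v.
  edge-split : ∀ a x y → 𝟙 a ≤ 𝟙 (a ∧ (not x ∧ not y)) + 𝟙 x * 𝟙 a + 𝟙 y * 𝟙 a
  edge-split false x     y     = z≤n
  edge-split true  false false = ≤-refl
  edge-split true  false true  = s≤s z≤n
  edge-split true  true  y     = s≤s z≤n
  row : ∀ u → ∑[ w < n ] (𝟙 (E H u w) + 𝟙 (at u) * 𝟙 (adj G u w) + 𝟙 (at w) * 𝟙 (adj G u w))
            ≡ degS H u + 𝟙 (at u) * deg G u + 𝟙 (adj G u v)
  row u = begin-equality
    ∑[ w < n ] (𝟙 (E H u w) + 𝟙 (at u) * 𝟙 (adj G u w) + 𝟙 (at w) * 𝟙 (adj G u w))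
      ≡⟨ trans (∑-distrib-+ {n} (λ w → 𝟙 (E H u w) + 𝟙 (at u) * 𝟙 (adj G u w))
                                (λ w → 𝟙 (at w) * 𝟙 (adj G u w)))
               (cong (_+ ∑[ w < n ] (𝟙 (at w) * 𝟙 (adj G u w)))
                     (∑-distrib-+ (𝟙 ∘ E H u) (λ w → 𝟙 (at u) * 𝟙 (adj G u w)))) ⟩
    ∑[ w < n ] 𝟙 (E H u w) + ∑[ w < n ] (𝟙 (at u) * 𝟙 (adj G u w)) + ∑[ w < n ] (𝟙 (at w) * 𝟙 (adj G u w))
      ≡⟨ cong₂ _+_ (cong₂ _+_ (sym (count≡∑𝟙 (E H u))) (sym (*-distribˡ-sum (𝟙 (at u)) (𝟙 ∘ adj G u))))
                   (∑-δ (𝟙 ∘ adj G u) v) ⟩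
    degS H u + 𝟙 (at u) * ∑[ w < n ] 𝟙 (adj G u w) + 𝟙 (adj G u v)
      ≡⟨ cong (λ d → degS H u + 𝟙 (at u) * d + 𝟙 (adj G u v)) (sym (count≡∑𝟙 (adj G u))) ⟩
    degS H u + 𝟙 (at u) * deg G u + 𝟙 (adj G u v)
      ∎

NoDenserProperSubgraph : ∀ {n} → Graph n → Set
NoDenserProperSubgraph {n} G =
  ∀ (H : Subgraph G) → Proper H → 0 < vcount H → degSumS H * n ≤ degSum G * vcount H

deletion-bound : ∀ D S e h → S * suc h ≤ D * h → D ≤ S + 2 * e → D ≤ 2 * suc h * e
deletion-bound D S e h S·n≤D·h D≤S+2e = +-cancelˡ-≤ (D * h) D (2 * suc h * e) (begin
  D * h + D             ≡⟨ solve (D ∷ h ∷ []) ⟩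
  D * suc h             ≤⟨ *-monoˡ-≤ (suc h) D≤S+2e ⟩
  (S + 2 * e) * suc h   ≡⟨ *-distribʳ-+ (suc h) S (2 * e) ⟩
  S * suc h + 2 * e * suc h  ≤⟨ +-mono-≤ S·n≤D·h (≤-reflexive (solve (e ∷ h ∷ []))) ⟩
  D * h + 2 * suc h * e ∎)
  where open ≤-Reasoning

degSum≤2n·deg : ∀ {n} (G : Graph n) → NoDenserProperSubgraph G → 2 ≤ n → ∀ v → degSum G ≤ 2 * n * deg G v
degSum≤2n·deg {n} G maximal 2≤n v = subst (λ m → degSum G ≤ 2 * m * deg G v) (sym n≡1+h)
  (deletion-bound (degSum G) (degSumS (G ─ v)) (deg G v) h
    (subst (λ m → degSumS (G ─ v) * m ≤ degSum G * h) n≡1+h (maximal (G ─ v) (─-proper G v) 0<h))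
    (degSum≤degSumS-─ G v))
  where
  h : ℕ
  h = vcount (G ─ v)
  n≡1+h : n ≡ suc h
  n≡1+h = trans (sym (vcount-─ G v)) (+-comm h 1)
  0<h : 0 < h
  0<h = s≤s⁻¹ (subst (2 ≤_) n≡1+h 2≤n)

-- Bipartite subgraphs

degInto : ∀ {n} → Graph n → (Fin n → Bool) → Fin n → ℕ
degInto G B x = count (λ y → adj G x y ∧ B y)

∑degInto≡∑deg : ∀ {n} (G : Graph n) (B : Fin n → Bool) →
  ∑[ x < n ] degInto G B x ≡ ∑[ y < n ] (𝟙 (B y) * deg G y)
∑degInto≡∑deg {n} G B = begin
  ∑[ x < n ] degInto G B x
    ≡⟨ sum-cong-≗ (λ x → count≡∑𝟙 (λ y → adj G x y ∧ B y)) ⟩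
  ∑[ x < n ] ∑[ y < n ] 𝟙 (adj G x y ∧ B y)
    ≡⟨ sum-cong-≗ (λ x → sum-cong-≗ (λ y → swap-edge x y)) ⟩
  ∑[ x < n ] ∑[ y < n ] (𝟙 (B y) * 𝟙 (adj G y x))
    ≡⟨ ∑-comm (λ x y → 𝟙 (B y) * 𝟙 (adj G y x)) ⟩
  ∑[ y < n ] ∑[ x < n ] (𝟙 (B y) * 𝟙 (adj G y x))
    ≡⟨ sum-cong-≗ (λ y → sym (*-distribˡ-sum (𝟙 (B y)) (𝟙 ∘ adj G y))) ⟩
  ∑[ y < n ] (𝟙 (B y) * ∑[ x < n ] 𝟙 (adj G y x))
    ≡⟨ sum-cong-≗ (λ y → cong (𝟙 (B y) *_) (sym (count≡∑𝟙 (adj G y)))) ⟩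
  ∑[ y < n ] (𝟙 (B y) * deg G y)
    ∎
  where
  open ≡-Reasoning
  swap-edge : ∀ x y → 𝟙 (adj G x y ∧ B y) ≡ 𝟙 (B y) * 𝟙 (adj G y x)
  swap-edge x y = trans (cong 𝟙 (trans (∧-comm (adj G x y) (B y)) (cong (B y ∧_) (Graph.sym G x y))))
                   (𝟙-∧ (B y) (adj G y x))

crossing : ∀ {n} (A B : Fin n → Bool) → Fin n → Fin n → Bool
crossing A B u w = A u ∧ B w ∨ B u ∧ A w

crossing-sym : ∀ {n} (A B : Fin n → Bool) u w → crossing A B u w ≡ crossing A B w u
crossing-sym A B u w = trans (∨-comm (A u ∧ B w) _) (cong₂ _∨_ (∧-comm (B u) (A w)) (∧-comm (A u) (B w)))

crossing⁻ : ∀ {n} {A B : Fin n → Bool} {u w} → crossing A B u w ≡ true →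
  (A u ≡ true × B w ≡ true) ⊎ (B u ≡ true × A w ≡ true)
crossing⁻ {A = A} {B} {u} {w} e with ∨-true⁻ {A u ∧ B w} e
... | inj₁ AB = inj₁ (∧-true⁻ AB)
... | inj₂ BA = inj₂ (∧-true⁻ BA)

between : ∀ {n} (G : Graph n) (A B : Fin n → Bool) → Subgraph G
between G A B = record
  { V     = λ u → A u ∨ B u
  ; E     = λ u w → crossing A B u w ∧ adj G u w
  ; E-sym = λ u w → cong₂ _∧_ (crossing-sym A B u w) (Graph.sym G u w)
  ; E⊆G   = λ u w → proj₂ ∘ ∧-true⁻ {crossing A B u w}
  ; E⊆V   = λ u w e → [ ∨-trueˡ (B u) ∘ proj₁ , ∨-trueʳ (A u) ∘ proj₁ ]′
                        (crossing⁻ {A = A} {B} (proj₁ (∧-true⁻ {crossing A B u w} e)))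
  }

between-isBipartition : ∀ {n} (G : Graph n) {A B : Fin n → Bool} →
  (∀ u → A u ≡ true → B u ≢ true) → IsBipartition (between G A B) A B
between-isBipartition G {A} {B} disjoint =
    (λ u (Au , Bu) → disjoint u Au Bu)
  , (λ u → ∨-true⁻)
  , (λ u → ∨-trueˡ (B u))
  , (λ u → ∨-trueʳ (A u))
  , (λ u w e → crossing⁻ {A = A} {B} (proj₁ (∧-true⁻ {crossing A B u w} e)))

degS-between-A : ∀ {n} (G : Graph n) {A B : Fin n → Bool} {x} → A x ≡ true → B x ≡ false →
  degS (between G A B) x ≡ degInto G B x
degS-between-A G {A} {B} {x} Ax Bx = count-cong edge-to-B
  where
  edge-to-B : ∀ w → crossing A B x w ∧ adj G x w ≡ adj G x w ∧ B w
  edge-to-B w rewrite Ax | Bx = trans (cong (_∧ adj G x w) (∨-identityʳ (B w))) (∧-comm (B w) (adj G x w))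

degS-between-≤ : ∀ {n} (G : Graph n) {A B : Fin n → Bool} x → degS (between G A B) x ≤ deg G x
degS-between-≤ G {A} {B} x = count-mono (λ w → proj₂ ∘ ∧-true⁻ {crossing A B x w})

*-^ : ∀ x y m → (x * y) ^ m ≡ x ^ m * y ^ m
*-^ x y zero    = refl
*-^ x y (suc m) = trans (cong (x * y *_) (*-^ x y m)) (interchange x y (x ^ m) (y ^ m))
  where
  interchange : ∀ a b c d → a * b * (c * d) ≡ a * c * (b * d)
  interchange = solve-∀

-- The m-th power of k a 2^i 2^q is at most (k a)^m 2^(i m) 2^i = (k a)^m 2^(k i).
below-threshold : ∀ m n a i q → q * m ≤ i → ¬ (n ^ m ≤ (suc m * a) ^ m * 2 ^ (suc m * i)) →
  suc m * a * 2 ^ i * 2 ^ q < n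
below-threshold m n a i q qm≤i above = ≰⇒> λ n≤X → above (begin
  n ^ m                                         ≤⟨ ^-monoˡ-≤ m n≤X ⟩
  (ka * 2 ^ i * 2 ^ q) ^ m                      ≡⟨ *-^ (ka * 2 ^ i) (2 ^ q) m ⟩
  (ka * 2 ^ i) ^ m * (2 ^ q) ^ m                ≡⟨ cong (_* (2 ^ q) ^ m) (*-^ ka (2 ^ i) m) ⟩
  ka ^ m * (2 ^ i) ^ m * (2 ^ q) ^ m            ≡⟨ cong₂ (λ x y → ka ^ m * x * y) (^-*-assoc 2 i m) (^-*-assoc 2 q m) ⟩
  ka ^ m * 2 ^ (i * m) * 2 ^ (q * m)            ≤⟨ *-monoʳ-≤ (ka ^ m * 2 ^ (i * m)) (^-monoʳ-≤ 2 qm≤i) ⟩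
  ka ^ m * 2 ^ (i * m) * 2 ^ i                  ≡⟨ trans (*-assoc (ka ^ m) _ _) (cong (ka ^ m *_) (sym 2^ki)) ⟩
  ka ^ m * 2 ^ (suc m * i)                      ∎)
  where
  open ≤-Reasoning
  ka : ℕ
  ka = suc m * a
  2^ki : 2 ^ (suc m * i) ≡ 2 ^ (i * m) * 2 ^ i
  2^ki = trans (cong (2 ^_) exponent) (^-distribˡ-+-* 2 (i * m) i)
    where
    exponent : suc m * i ≡ i * m + i
    exponent = solve (m ∷ i ∷ [])

n<2^n : ∀ n → n < 2 ^ n
n<2^n zero    = s≤s z≤n
n<2^n (suc n) = +-mono-≤ (m^n>0 2 n) (subst (suc n ≤_) (sym (+-identityʳ (2 ^ n))) (n<2^n n))

last-satisfying : ∀ {P : ℕ → Set} → Decidable P → P 0 → ∀ T → ¬ P T → ∃[ j ] j < T × P j × ¬ P (suc j)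
last-satisfying P? P0 zero    ¬PT = contradiction P0 ¬PT
last-satisfying P? P0 (suc T) ¬PT with P? T
... | yes PT  = T , ≤-refl , PT , ¬PT
... | no  ¬PT′ with last-satisfying P? P0 T ¬PT′
...   | j , j<T , Pj , ¬Pj+1 = j , m≤n⇒m≤1+n j<T , Pj , ¬Pj+1

dyadic-level : ∀ {D t} → 0 < D → D ≤ t → ∃[ j ] j < t × 2 ^ j * D ≤ t × t < 2 ^ suc j * D
dyadic-level {D} {t} 0<D D≤t
  with last-satisfying (λ j → 2 ^ j * D ≤? t) (subst (_≤ t) (sym (+-identityʳ D)) D≤t) t ¬2^tD≤t
  where
  ¬2^tD≤t : ¬ (2 ^ t * D ≤ t)
  ¬2^tD≤t = <⇒≱ (<-≤-trans (n<2^n t) (m≤m*n (2 ^ t) D {{>-nonZero 0<D}}))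
... | j , j<t , lower , ¬upper = j , j<t , lower , ≰⇒> ¬upper

double-counting-bound : ∀ n D b s → 3 * n ≤ 8 * b → D * b ≤ 2 * n * s → 6 * (n * D) ≤ 32 * n * s
double-counting-bound n D b s 3n≤8b Db≤2ns = begin
  6 * (n * D)         ≡⟨ solve (n ∷ D ∷ []) ⟩
  2 * D * (3 * n)     ≤⟨ *-monoʳ-≤ (2 * D) 3n≤8b ⟩
  2 * D * (8 * b)     ≡⟨ solve (D ∷ b ∷ []) ⟩
  16 * (D * b)        ≤⟨ *-monoʳ-≤ 16 Db≤2ns ⟩
  16 * (2 * n * s)    ≡⟨ solve (n ∷ s ∷ []) ⟩
  32 * n * s          ∎
  where open ≤-Reasoning

-- Dyadic levels of the degrees into B

DyadicSubgraph : ℕ → ∀ {n} → Graph n → Set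
DyadicSubgraph k {n} G = Σ (Subgraph G) λ H → Σ (Fin n → Bool) λ A → Σ (Fin n → Bool) λ B →
  IsBipartition H A B × Σ ℕ λ i → 1 ≤ i ×
    ((n ^ (k ∸ 1) ≤ (k * count A) ^ (k ∸ 1) * 2 ^ (k * i)) × n ≤ 64 * count B) ×
    (∀ a → A a ≡ true → (2 ^ i * degSum G ≤ 64 * n * degS H a) × (32 * n * degS H a ≤ 2 ^ i * degSum G)) ×
    (∀ b → B b ≡ true → n * degS H b ≤ 4 * degSum G)

module Levels {n} (G : Graph n) (side B : Fin n → Bool)
  (coloured : ∀ u v → adj G u v ≡ true → side u ≢ side v)
  (B⊆side : ∀ b → B b ≡ true → side b ≡ true) where

  D : ℕ
  D = degSum G

  scaled : Fin n → ℕ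
  scaled x = 32 * n * degInto G B x

  -- The paper's degree window [2^(i-6) d, 2^(i-5) d] for i = j + 1, multiplied by 32 n.
  level : ℕ → Fin n → Bool
  level j x = not (side x) ∧ (2 ^ j * D ≤ᵇ scaled x) ∧ (scaled x <ᵇ 2 ^ suc j * D)

  level⁻ : ∀ {j x} → level j x ≡ true → side x ≡ false × 2 ^ j * D ≤ scaled x × scaled x < 2 ^ suc j * D
  level⁻ {j} {x} e with side x | ∧-true⁻ {not (side x)} e
  ... | false | _ , bounds with ∧-true⁻ {2 ^ j * D ≤ᵇ scaled x} bounds
  ...   | lower , upper = refl , ≤ᵇ⇒≤ _ _ (true⇒T lower) , <ᵇ⇒< _ _ (true⇒T upper)

  level⁺ : ∀ {j x} → side x ≡ false → 2 ^ j * D ≤ scaled x → scaled x < 2 ^ suc j * D → level j x ≡ true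
  level⁺ {x = x} side-x lower upper rewrite side-x = ∧-true⁺ (T⇒true (≤⇒≤ᵇ lower)) (T⇒true (<⇒<ᵇ upper))

  degInto-side : ∀ x → side x ≡ true → degInto G B x ≡ 0
  degInto-side x side-x =
    trans (count≡∑𝟙 (λ y → adj G x y ∧ B y)) (trans (sum-cong-≗ no-edge) (trans (∑-const n 0) (*-zeroʳ n)))
    where
    no-edge : ∀ y → 𝟙 (adj G x y ∧ B y) ≡ 0
    no-edge y with adj G x y in xy | B y in By
    ... | true  | true  = contradiction (trans side-x (sym (B⊆side y By))) (coloured x y xy)
    ... | true  | false = refl
    ... | false | _     = refl

  scaled≤ : ∀ x → scaled x ≤ 32 * n * n
  scaled≤ x = *-monoʳ-≤ (32 * n) (count≤n (λ y → adj G x y ∧ B y))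

  weight : ℕ → Fin n → ℕ
  weight j x = 𝟙 (level j x) * 2 ^ suc j

  level-term : ∀ {N} j x → j < N → level j x ≡ true → 2 ^ suc j ≤ ∑[ i < N ] weight (toℕ i) x
  level-term {N} j x j<N in-level = begin
    2 ^ suc j                    ≡⟨ sym (*-identityˡ _) ⟩
    𝟙 true * 2 ^ suc j           ≡⟨ cong (λ b → 𝟙 b * 2 ^ suc j) (sym in-level) ⟩
    weight j x                   ≡⟨ cong (λ i → weight i x) (sym (toℕ-fromℕ< j<N)) ⟩
    weight (toℕ (fromℕ< j<N)) x  ≤⟨ ∑-term (λ (i : Fin N) → weight (toℕ i) x) (fromℕ< j<N) ⟩
    ∑[ i < N ] weight (toℕ i) x  ∎
    where open ≤-Reasoning

  level-covering : 0 < D → ∀ {N} → 32 * n * n ≤ N → ∀ x → scaled x ≤ D + D * ∑[ j < N ] weight (toℕ j) x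
  level-covering 0<D {N} bound x with D ≤? scaled x
  ... | no  D≰s = ≤-trans (<⇒≤ (≰⇒> D≰s)) (m≤m+n D _)
  ... | yes D≤s = ≤-trans (by-side (side x) refl) (m≤n+m _ D)
    where
    by-side : ∀ b → side x ≡ b → scaled x ≤ D * ∑[ j < N ] weight (toℕ j) x
    by-side true  side-x = subst (_≤ D * ∑[ j < N ] weight (toℕ j) x)
                                 (sym (trans (cong (32 * n *_) (degInto-side x side-x)) (*-zeroʳ (32 * n)))) z≤n
    by-side false side-x with dyadic-level 0<D D≤s
    ... | j , j<s , lower , upper = begin
      scaled x                          ≤⟨ <⇒≤ upper ⟩
      2 ^ suc j * D                     ≡⟨ *-comm (2 ^ suc j) D ⟩
      D * 2 ^ suc j                     ≤⟨ *-monoʳ-≤ D (level-term j x j<N (level⁺ {j} side-x lower upper)) ⟩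
      D * ∑[ j < N ] weight (toℕ j) x   ∎
      where
      open ≤-Reasoning
      j<N : j < N
      j<N = <-≤-trans j<s (≤-trans (scaled≤ x) bound)

  level-disjoint : ∀ j u → level j u ≡ true → B u ≢ true
  level-disjoint j u in-level Bu with () ← trans (sym (proj₁ (level⁻ {j} in-level))) (B⊆side u Bu)

  levelGraph : ℕ → Subgraph G
  levelGraph j = between G (level j) B

  degS-levelGraph : ∀ j x → level j x ≡ true → degS (levelGraph j) x ≡ degInto G B x
  degS-levelGraph j x in-level = degS-between-A G in-level (¬-not (level-disjoint j x in-level))

  size : ℕ → ℕ
  size j = count (level j)

  ∑weight≡size : ∀ j → ∑[ x < n ] weight j x ≡ size j * 2 ^ suc j
  ∑weight≡size j =
    sym (trans (cong (_* 2 ^ suc j) (count≡∑𝟙 (level j))) (*-distribʳ-sum (2 ^ suc j) (𝟙 ∘ level j)))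

  module Dense (min-degree : ∀ v → D ≤ 2 * n * deg G v) (B-large : 3 * n ≤ 8 * count B)
    (m : ℕ) .{{_ : NonZero m}} where

    k : ℕ
    k = suc m

    Large : ℕ → Set
    Large j = n ^ m ≤ (k * size j) ^ m * 2 ^ (k * suc j)

    N : ℕ
    N = 32 * n * n * m

    D·|B|≤ : D * count B ≤ 2 * n * ∑[ b < n ] (𝟙 (B b) * deg G b)
    D·|B|≤ = begin
      D * count B                            ≡⟨ cong (D *_) (count≡∑𝟙 B) ⟩
      D * ∑[ b < n ] 𝟙 (B b)                 ≡⟨ *-distribˡ-sum D (𝟙 ∘ B) ⟩
      ∑[ b < n ] (D * 𝟙 (B b))               ≤⟨ ∑-mono-≤ per-vertex ⟩
      ∑[ b < n ] (2 * n * (𝟙 (B b) * deg G b))  ≡⟨ sym (*-distribˡ-sum (2 * n) (λ b → 𝟙 (B b) * deg G b)) ⟩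
      2 * n * ∑[ b < n ] (𝟙 (B b) * deg G b) ∎
      where
      open ≤-Reasoning
      per-vertex : ∀ b → D * 𝟙 (B b) ≤ 2 * n * (𝟙 (B b) * deg G b)
      per-vertex b = subst₂ _≤_ (*-comm (𝟙 (B b)) D) (x∙yz≈y∙xz (𝟙 (B b)) (2 * n) (deg G b))
                       (*-monoʳ-≤ (𝟙 (B b)) (min-degree b))

    ∑scaled-lower : 6 * (n * D) ≤ ∑ scaled
    ∑scaled-lower = begin
      6 * (n * D)                 ≤⟨ double-counting-bound n D (count B) _ B-large D·|B|≤ ⟩
      32 * n * ∑[ b < n ] (𝟙 (B b) * deg G b) ≡⟨ cong (32 * n *_) (sym (∑degInto≡∑deg G B)) ⟩
      32 * n * ∑ (degInto G B)     ≡⟨ *-distribˡ-sum (32 * n) (degInto G B) ⟩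
      ∑ scaled                     ∎
      where open ≤-Reasoning

    weights-bound : (∀ (j : Fin N) → ¬ Large (toℕ j)) → ∑[ j < N ] (size (toℕ j) * 2 ^ suc (toℕ j)) ≤ 2 * n
    weights-bound small = ∑-blocks-bound (32 * n * n) m n (λ j → size (toℕ j) * 2 ^ suc (toℕ j)) block
      where
      block : ∀ (q : Fin (32 * n * n)) (r : Fin m) →
        m * 2 ^ toℕ q * (size (toℕ (combine q r)) * 2 ^ suc (toℕ (combine q r))) ≤ n
      block q r = <⇒≤ (≤-<-trans (reorder m (2 ^ toℕ q) (size j) (2 ^ suc j))
                                 (below-threshold m n (size j) (suc j) (toℕ q) qm≤1+j (small (combine q r))))
        where
        j : ℕ
        j = toℕ (combine q r)
        qm≤1+j : toℕ q * m ≤ suc j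
        qm≤1+j = ≤-trans (≤-reflexive (*-comm (toℕ q) m))
                   (≤-trans (m≤m+n (m * toℕ q) (toℕ r)) (≤-trans (≤-reflexive (sym (toℕ-combine q r))) (n≤1+n j)))
        reorder : ∀ m x a y → m * x * (a * y) ≤ suc m * a * y * x
        reorder m x a y = begin
          m * x * (a * y)      ≡⟨ solve (m ∷ x ∷ a ∷ y ∷ []) ⟩
          m * (a * y * x)      ≤⟨ *-monoˡ-≤ (a * y * x) (n≤1+n m) ⟩
          suc m * (a * y * x)  ≡⟨ solve (m ∷ x ∷ a ∷ y ∷ []) ⟩
          suc m * a * y * x    ∎
          where open ≤-Reasoning

    ∑scaled-upper : 0 < D → (∀ (j : Fin N) → ¬ Large (toℕ j)) → ∑ scaled ≤ 3 * (n * D)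
    ∑scaled-upper 0<D small = begin
      ∑ scaled
        ≤⟨ ∑-mono-≤ (level-covering 0<D (m≤m*n (32 * n * n) m)) ⟩
      ∑[ x < n ] (D + D * ∑[ j < N ] weight (toℕ j) x)
        ≡⟨ trans (∑-distrib-+ (λ _ → D) (λ x → D * ∑[ j < N ] weight (toℕ j) x))
                 (cong₂ _+_ (∑-const n D) (sym (*-distribˡ-sum D (λ x → ∑[ j < N ] weight (toℕ j) x)))) ⟩
      n * D + D * ∑[ x < n ] ∑[ j < N ] weight (toℕ j) x
        ≡⟨ cong (λ s → n * D + D * s) (trans (∑-comm (λ (x : Fin n) (j : Fin N) → weight (toℕ j) x))
                                             (sum-cong-≗ (λ (j : Fin N) → ∑weight≡size (toℕ j)))) ⟩
      n * D + D * ∑[ j < N ] (size (toℕ j) * 2 ^ suc (toℕ j))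
        ≤⟨ +-monoʳ-≤ (n * D) (*-monoʳ-≤ D (weights-bound small)) ⟩
      n * D + D * (2 * n)
        ≡⟨ collect n D ⟩
      3 * (n * D)
        ∎
      where
      open ≤-Reasoning
      collect : ∀ a b → a * b + b * (2 * a) ≡ 3 * (a * b)
      collect = solve-∀

    some-level-large : 0 < n → 0 < D → ∃[ j ] Large j
    some-level-large 0<n 0<D with any? (λ (j : Fin N) → n ^ m ≤? (k * size (toℕ j)) ^ m * 2 ^ (k * suc (toℕ j)))
    ... | yes (j , large) = toℕ j , large
    ... | no none = contradiction (≤-trans ∑scaled-lower (∑scaled-upper 0<D (λ j large → none (j , large)))) 6x≰3x
      where
      6x≰3x : ¬ (6 * (n * D) ≤ 3 * (n * D))
      6x≰3x = <⇒≱ (*-monoˡ-< (n * D) {{>-nonZero (*-mono-≤ 0<n 0<D)}} {3} {6} (s≤s (s≤s (s≤s (s≤s z≤n)))))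

    dyadic-subgraph : (∀ b → B b ≡ true → n * deg G b ≤ 4 * D) → 0 < n → 0 < D → DyadicSubgraph k G
    dyadic-subgraph B-low 0<n 0<D with some-level-large 0<n 0<D
    ... | j , large =
      levelGraph j , level j , B , between-isBipartition G (level-disjoint j) ,
      suc j , s≤s z≤n , (large , n≤64|B|) , window , B-low-in-H
      where
      n≤64|B| : n ≤ 64 * count B
      n≤64|B| = ≤-trans (m≤n*m n 3) (≤-trans B-large (*-monoˡ-≤ (count B) (m≤m*n 8 8)))
      window : ∀ a → level j a ≡ true →
        (2 ^ suc j * D ≤ 64 * n * degS (levelGraph j) a) × (32 * n * degS (levelGraph j) a ≤ 2 ^ suc j * D)
      window a in-level rewrite degS-levelGraph j a in-level with level⁻ {j} in-level
      ... | _ , lower , upper = subst₂ _≤_ (sym (*-assoc 2 (2 ^ j) D)) 2·32n≡64n (*-monoʳ-≤ 2 lower) , <⇒≤ upper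
        where
        2·32n≡64n : 2 * (32 * n * degInto G B a) ≡ 64 * n * degInto G B a
        2·32n≡64n = trans (sym (*-assoc 2 (32 * n) _)) (cong (_* degInto G B a) (sym (*-assoc 2 32 n)))
      B-low-in-H : ∀ b → B b ≡ true → n * degS (levelGraph j) b ≤ 4 * D
      B-low-in-H b Bb = ≤-trans (*-monoʳ-≤ n (degS-between-≤ G {level j} {B} b)) (B-low b Bb)

-- Low-degree vertices and the theorem

lowDegree : ∀ {n} → Graph n → Fin n → Bool
lowDegree {n} G v = n * deg G v ≤ᵇ 4 * degSum G

count-all : ∀ n → count {n} (λ _ → true) ≡ n
count-all n = trans (count≡∑𝟙 {n} (λ _ → true)) (trans (∑-const n 1) (*-identityʳ n))

most-vertices-low : ∀ {n} (G : Graph n) → 0 < degSum G → 3 * n ≤ 4 * count (lowDegree G)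
most-vertices-low {n} G 0<D = +-cancelʳ-≤ (4 * high) (3 * n) (4 * low) (begin
  3 * n + 4 * high    ≤⟨ +-monoʳ-≤ (3 * n) 4·high≤n ⟩
  3 * n + n           ≡⟨ solve (n ∷ []) ⟩
  4 * n               ≡⟨ cong (4 *_) (trans (sym (count-all n)) (count-∧-split (λ _ → true) (lowDegree G))) ⟩
  4 * (low + high)    ≡⟨ *-distribˡ-+ 4 low high ⟩
  4 * low + 4 * high  ∎)
  where
  open ≤-Reasoning
  D low high : ℕ
  D    = degSum G
  low  = count (lowDegree G)
  high = count (λ v → not (lowDegree G v))
  4·high≤n : 4 * high ≤ n
  4·high≤n = *-cancelʳ-≤ (4 * high) n D {{>-nonZero 0<D}} (begin
    4 * high * D     ≡⟨ xy∙z≈xz∙y 4 high D ⟩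
    4 * D * high     ≤⟨ count-above (λ v → n * deg G v) (4 * D) ⟩
    ∑[ v < n ] (n * deg G v)  ≡⟨ sym (trans (cong (n *_) (degSum≡∑deg G)) (*-distribˡ-sum n (deg G))) ⟩
    n * D            ∎)

twice : ∀ {s} x → s ≤ x + x → 4 * s ≤ 8 * x
twice {s} x s≤2x = begin
  4 * s        ≤⟨ *-monoʳ-≤ 4 s≤2x ⟩
  4 * (x + x)  ≡⟨ solve (x ∷ []) ⟩
  8 * x        ∎
  where open ≤-Reasoning

larger-half : ∀ {n} (p c : Fin n → Bool) →
  4 * count p ≤ 8 * count (λ v → p v ∧ c v) ⊎ 4 * count p ≤ 8 * count (λ v → p v ∧ not (c v))
larger-half p c with count (λ v → p v ∧ c v) ≤? count (λ v → p v ∧ not (c v))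
... | yes x≤y = inj₂ (twice y (≤-trans (≤-reflexive (count-∧-split p c)) (+-monoˡ-≤ y x≤y)))
  where
  y : ℕ
  y = count (λ v → p v ∧ not (c v))
... | no  x≰y = inj₁ (twice x (≤-trans (≤-reflexive (count-∧-split p c)) (+-monoʳ-≤ x (<⇒≤ (≰⇒> x≰y)))))
  where
  x : ℕ
  x = count (λ v → p v ∧ c v)

dyadic-subgraph-on-side : ∀ m {n} (G : Graph n) (side : Fin n → Bool) →
  (∀ u v → adj G u v ≡ true → side u ≢ side v) → 0 < degSum G → NoDenserProperSubgraph G →
  3 * n ≤ 8 * count (λ v → lowDegree G v ∧ side v) → DyadicSubgraph (suc (suc m)) G
dyadic-subgraph-on-side m {n} G side coloured 0<D maximal many =
  Levels.Dense.dyadic-subgraph G side B coloured (λ b → proj₂ ∘ ∧-true⁻ {lowDegree G b})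
    (degSum≤2n·deg G maximal 2≤n) many (suc m) B-low (≤-trans (s≤s z≤n) 2≤n) 0<D
  where
  B : Fin n → Bool
  B v = lowDegree G v ∧ side v
  2≤n : 2 ≤ n
  2≤n = degSum-positive⇒2≤n G 0<D
  B-low : ∀ b → B b ≡ true → n * deg G b ≤ 4 * degSum G
  B-low b = ≤ᵇ⇒≤ _ _ ∘ true⇒T ∘ proj₁ ∘ ∧-true⁻

lemma3p2 : (k n : ℕ) → 2 ≤ k → (G : Graph n) → Bipartite G → 0 < degSum G →
    (∀ (H : Subgraph G) → Proper H → 0 < vcount H → degSumS H * n ≤ degSum G * vcount H) →
    Σ (Subgraph G) λ H → Σ (Fin n → Bool) λ A → Σ (Fin n → Bool) λ B →
      IsBipartition H A B × Σ ℕ λ i → 1 ≤ i ×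
        ((n ^ (k ∸ 1) ≤ (k * count A) ^ (k ∸ 1) * 2 ^ (k * i)) × n ≤ 64 * count B) ×
        (∀ a → A a ≡ true → (2 ^ i * degSum G ≤ 64 * n * degS H a) × (32 * n * degS H a ≤ 2 ^ i * degSum G)) ×
        (∀ b → B b ≡ true → n * degS H b ≤ 4 * degSum G)
lemma3p2 (suc (suc m)) n (s≤s (s≤s _)) G (c , coloured) 0<D maximal
  with larger-half (lowDegree G) c | most-vertices-low G 0<D
... | inj₁ many | most-low =
  dyadic-subgraph-on-side m G c coloured 0<D maximal (≤-trans most-low many)
... | inj₂ many | most-low =
  dyadic-subgraph-on-side m G (not ∘ c) (λ u v e → coloured u v e ∘ not-injective) 0<D maximal (≤-trans most-low many)
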